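{- The graph $G_0$ (defined in the context) satisfies $\chi_\rho(G_0)\ge 9$.
   Context: For a positive integer $i$, an $i$-packing in a graph $G$ is a set $W\subseteq V(G)$ such that any two distinct vertices of $W$ are at (shortest-path) distance greater than $i$. The packing chromatic number $\chi_\rho(G)$ is the smallest integer $k$ such that $V(G)$ can be partitioned into sets $V_1,\dots,V_k$ with $V_i$ an $i$-packing for each $i$. The graph $H$ has 15 vertices $y_1,\dots,y_7,z_1,\dots,z_7,w$ and edges $y_1y_5, y_5y_6, y_6y_7, y_7y_3, y_3y_2, y_2y_1, y_2y_4, y_4y_6$, the analogous edges $z_1z_5, z_5z_6, z_6z_7, z_7z_3, z_3z_2, z_2z_1, z_2z_4, z_4z_6$, and the edges $y_4w, wz_4, y_3z_1, y_5z_7$. The graph $G_0$ is obtained from two disjoint copies $H^{(1)}, H^{(2)}$ of $H$ (the vertex of $H^{(j)}$ corresponding to $v\in V(H)$ is written $v^{(j)}$) by adding five new vertices $a,b,c,d,x$ and the edges: $a$ adjacent to $y_1^{(1)}$ and $y_1^{(2)}$; $b$ adjacent to $z_3^{(1)}$ and $z_3^{(2)}$; $c$ adjacent to $y_7^{(1)}$ and $z_5^{(2)}$; $d$ adjacent to $z_5^{(1)}$ and $y_7^{(2)}$; $x$ adjacent to $w^{(1)}$ and $w^{(2)}$. -}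

module Defs where

open import Data.Nat using (ℕ; zero; suc; _≤_)
open import Data.Fin using (Fin)
open import Data.Product using (Σ; _×_)
open import Data.Sum using (_⊎_)
open import Relation.Binary.PropositionalEquality using (_≡_)
open import Relation.Nullary using (¬_)

data HV : Set where
  y1 y2 y3 y4 y5 y6 y7 z1 z2 z3 z4 z5 z6 z7 w : HV

-- Edges of H (each undirected edge listed once)
data HEdge : HV → HV → Set where
  e1 : HEdge y1 y5
  e2 : HEdge y5 y6
  e3 : HEdge y6 y7
  e4 : HEdge y7 y3
  e5 : HEdge y3 y2
  e6 : HEdge y2 y1
  e7 : HEdge y2 y4
  e8 : HEdge y4 y6
  f1 : HEdge z1 z5
  f2 : HEdge z5 z6
  f3 : HEdge z6 z7
  f4 : HEdge z7 z3
  f5 : HEdge z3 z2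
  f6 : HEdge z2 z1
  f7 : HEdge z2 z4
  f8 : HEdge z4 z6
  g1 : HEdge y4 w
  g2 : HEdge w z4
  g3 : HEdge y3 z1
  g4 : HEdge y5 z7

-- Vertices of G0: two copies of H (indexed by Fin 2: copy 0 = H^(1), copy 1 = H^(2))
-- plus a, b, c, d, x
data V : Set where
  h : Fin 2 → HV → V
  a b c d x : V

pattern one = Fin.zero
pattern two = Fin.suc Fin.zero

-- Edges of G0 (each undirected edge listed once)
data Edge : V → V → Set where
  inH : ∀ {j u v} → HEdge u v → Edge (h j u) (h j v)
  ea1 : Edge a (h one y1)
  ea2 : Edge a (h two y1)
  eb1 : Edge b (h one z3)
  eb2 : Edge b (h two z3)
  ec1 : Edge c (h one y7)
  ec2 : Edge c (h two z5)
  ed1 : Edge d (h one z5)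
  ed2 : Edge d (h two y7)
  ex1 : Edge x (h one w)
  ex2 : Edge x (h two w)

Adj : V → V → Set
Adj u v = Edge u v ⊎ Edge v u

data Walk : V → V → ℕ → Set where
  here : ∀ {u} → Walk u u zero
  step : ∀ {u v t n} → Adj u v → Walk v t n → Walk u t (suc n)

DistLE : V → V → ℕ → Set
DistLE u v n = Σ ℕ (λ m → m ≤ n × Walk u v m)

-- A packing colouring of G0 with colours 1..k: colour class i is an i-packing,
-- i.e. distinct vertices with the same colour i are at distance > i.
PackingColouring : ℕ → Set
PackingColouring k =
  Σ (V → ℕ) (λ f →
     ((v : V) → 1 ≤ f v × f v ≤ k)
   × ((u v : V) → ¬ (u ≡ v) → f u ≡ f v → ¬ DistLE u v (f u)))

module Submission where

open import Defs
open import Data.Nat using (ℕ; _<_)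
open import Relation.Nullary using (¬_)

-- χ_ρ(G₀) ≥ 9.  Let f be a packing colouring of G₀ with colours 1..8.
-- (A) H has no packing colouring with colours 1..6: an exhaustive
--     backtracking search over H, using its distance table, each entry of
--     which is certified by an explicit path found by a bounded path search.
-- (B) So each copy of H uses at least two of the colours 6, 7, 8: otherwise
--     capping f at 6 on that copy would contradict (A).
-- (C) Two subsets of {6, 7, 8} that each miss at most one element meet, so
--     some colour k ≥ 6 occurs on both copies.
-- (D) Every vertex of one copy is within distance 6 of every vertex of the
--     other (a path search in G₀), so those two vertices of colour k clash.

open import Data.Nat using (zero; suc; _+_; _≤_; z≤n; s≤s; _⊓_; _≤?_)
import Data.Nat as ℕ
open import Data.Nat.Properties using (≤-trans; ≤-pred; m≤m+n; m⊓n≤m; m⊓n≤n; suc-injective)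
open import Data.Fin using (Fin; toℕ)
import Data.Fin as Fin
open import Data.Fin.Patterns using (0F; 1F; 2F; 3F; 4F)
open import Data.Fin.Properties using (all?; any?)
open import Data.Bool using (Bool; false; T; _∨_)
open import Data.Bool.Properties using (T-∨)
open import Data.Bool.ListAction using (all; any)
open import Data.List using (List; []; _∷_; _++_; applyUpTo)
import Data.List as List
open import Data.List.Relation.Unary.All using (All; []; _∷_)
import Data.List.Relation.Unary.All as All
open import Data.List.Relation.Unary.All.Properties using (all⁺)
open import Data.List.Membership.Propositional using (_∈_)
open import Data.List.Membership.Propositional.Properties using (∈-applyUpTo⁺)
open import Data.Maybe using (Maybe; just; nothing; is-just; to-witness-T; _<∣>_)
import Data.Maybe as Maybe
open import Data.Product using (Σ; _×_; _,_; proj₁; proj₂)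
import Data.Product.Properties as Product
open import Data.Sum using (_⊎_; inj₁; inj₂; [_,_]; map₂; swap)
import Data.Sum.Properties as Sum
open import Data.Vec using (Vec; []; _∷_; lookup)
open import Data.Empty using (⊥; ⊥-elim)
open import Function using (_∘_; id; Equivalence)
open import Relation.Nullary using (yes; no)
open import Relation.Nullary.Decidable using (Dec; map′; T?; toWitness)
open import Relation.Binary.Definitions using (DecidableEquality)
open import Relation.Binary.PropositionalEquality using (_≡_; _≢_; refl; sym; trans; cong; subst)

data Path {A : Set} (_⟶_ : A → A → Set) : A → A → ℕ → Set where
  []  : ∀ {u} → Path _⟶_ u u zero
  _∷_ : ∀ {u v t n} → u ⟶ v → Path _⟶_ v t n → Path _⟶_ u t (suc n)

Within : {A : Set} → (A → A → Set) → A → A → ℕ → Set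
Within _⟶_ u v n = Σ ℕ λ m → m ≤ n × Path _⟶_ u v m

within-mono : ∀ {A} {_⟶_ : A → A → Set} {u v m n} → m ≤ n →
              Within _⟶_ u v m → Within _⟶_ u v n
within-mono m≤n (l , l≤m , p) = l , ≤-trans l≤m m≤n , p

module PathSearch {A : Set} {_⟶_ : A → A → Set} (_≟_ : DecidableEquality A)
                  (neighbours : (u : A) → List (Σ A (u ⟶_))) where

  pathWithin? : (n : ℕ) (u v : A) → Maybe (Within _⟶_ u v n)
  pathWithin? n u v with u ≟ v
  ... | yes refl = just (zero , z≤n , [])
  pathWithin? zero    u v | no _ = nothing
  pathWithin? (suc n) u v | no _ = firstVia (neighbours u)
    where
    extend : ∀ {t} → u ⟶ t → Within _⟶_ t v n → Within _⟶_ u v (suc n)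
    extend e (m , m≤n , p) = suc m , s≤s m≤n , e ∷ p

    firstVia : List (Σ A (u ⟶_)) → Maybe (Within _⟶_ u v (suc n))
    firstVia []             = nothing
    firstVia ((t , e) ∷ ts) = Maybe.map (extend e) (pathWithin? n t v) <∣> firstVia ts

module Refutation {A : Set} (Bad : A → ℕ → A → ℕ → Set)
                  (bad? : ∀ u k v l → Maybe (Bad u k v l)) (colours : List ℕ) where

  clashes : A → ℕ → List (A × ℕ) → Bool
  clashes v k assigned = any (λ (u , l) → is-just (bad? u l v k)) assigned

  refutes : List A → List (A × ℕ) → Bool
  refutes []       assigned = false
  refutes (v ∷ vs) assigned =
    all (λ k → clashes v k assigned ∨ refutes vs ((v , k) ∷ assigned)) colours

  Agrees : (A → ℕ) → List (A × ℕ) → Set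
  Agrees g assigned = All (λ (u , l) → g u ≡ l) assigned

  BadPair : (A → ℕ) → Set
  BadPair g = Σ A λ u → Σ A λ v → Bad u (g u) v (g v)

  clashes-sound : ∀ {g v} assigned → Agrees g assigned →
                  T (clashes v (g v) assigned) → BadPair g
  clashes-sound {g} {v} ((u , _) ∷ assigned) (refl ∷ agrees) clash
    with Equivalence.to (T-∨ {is-just (bad? u (g u) v (g v))}) clash
  ... | inj₁ found = u , v , to-witness-T (bad? u (g u) v (g v)) found
  ... | inj₂ later = clashes-sound assigned agrees later

  refutes-sound : (g : A → ℕ) → (∀ v → g v ∈ colours) →
                  ∀ vs assigned → Agrees g assigned → T (refutes vs assigned) → BadPair g
  refutes-sound g g∈ (v ∷ vs) assigned agrees refuted
    with Equivalence.to T-∨ (All.lookup (all⁺ _ colours refuted) (g∈ v))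
  ... | inj₁ clash  = clashes-sound assigned agrees clash
  ... | inj₂ deeper = refutes-sound g g∈ vs ((v , g v) ∷ assigned) (refl ∷ agrees) deeper

MissesAtMostOne : {A : Set} → (A → Set) → A → A → A → Set
MissesAtMostOne P k₁ k₂ k₃ = (P k₁ ⊎ P k₂) × (P k₁ ⊎ P k₃) × (P k₂ ⊎ P k₃)

common-of-three : {A : Set} {P Q : A → Set} {k₁ k₂ k₃ : A} →
                  MissesAtMostOne P k₁ k₂ k₃ → MissesAtMostOne Q k₁ k₂ k₃ →
                  Σ A λ k → P k × Q k
common-of-three {k₁ = k₁} (inj₁ p₁ , _ , _) (inj₁ q₁ , _ , _) = k₁ , p₁ , q₁
common-of-three {k₂ = k₂} (inj₂ p₂ , _ , _) (inj₂ q₂ , _ , _) = k₂ , p₂ , q₂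
common-of-three {k₁ = k₁} {k₂} {k₃} (inj₁ p₁ , _ , p₂₃) (inj₂ q₂ , q₁₃ , _) with p₂₃ | q₁₃
... | inj₁ p₂ | _      = k₂ , p₂ , q₂
... | inj₂ _  | inj₁ q₁ = k₁ , p₁ , q₁
... | inj₂ p₃ | inj₂ q₃ = k₃ , p₃ , q₃
common-of-three {k₁ = k₁} {k₂} {k₃} (inj₂ p₂ , p₁₃ , _) (inj₁ q₁ , _ , q₂₃) with p₁₃ | q₂₃
... | inj₁ p₁ | _      = k₁ , p₁ , q₁
... | inj₂ _  | inj₁ q₂ = k₂ , p₂ , q₂
... | inj₂ p₃ | inj₂ q₃ = k₃ , p₃ , q₃

⊓-collision : ∀ k n m → n ⊓ k ≡ m ⊓ k → n ≡ m ⊎ (k ≤ n × k ≤ m)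
⊓-collision zero    n       m       _  = inj₂ (z≤n , z≤n)
⊓-collision (suc k) zero    zero    _  = inj₁ refl
⊓-collision (suc k) (suc n) (suc m) eq with ⊓-collision k n m (suc-injective eq)
... | inj₁ n≡m         = inj₁ (cong suc n≡m)
... | inj₂ (k≤n , k≤m) = inj₂ (s≤s k≤n , s≤s k≤m)

⊓-colour : ∀ k {n} → 1 ≤ n → n ⊓ suc k ∈ applyUpTo suc (suc k)
⊓-colour k {suc n} _ = ∈-applyUpTo⁺ suc (s≤s (m⊓n≤n n k))

HAdj : HV → HV → Set
HAdj u v = HEdge u v ⊎ HEdge v u

hNeighbours : (u : HV) → List (Σ HV (HAdj u))
hNeighbours y1 = (y5 , inj₁ e1) ∷ (y2 , inj₂ e6) ∷ []
hNeighbours y2 = (y3 , inj₂ e5) ∷ (y1 , inj₁ e6) ∷ (y4 , inj₁ e7) ∷ []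
hNeighbours y3 = (y7 , inj₂ e4) ∷ (y2 , inj₁ e5) ∷ (z1 , inj₁ g3) ∷ []
hNeighbours y4 = (y2 , inj₂ e7) ∷ (y6 , inj₁ e8) ∷ (w , inj₁ g1) ∷ []
hNeighbours y5 = (y1 , inj₂ e1) ∷ (y6 , inj₁ e2) ∷ (z7 , inj₁ g4) ∷ []
hNeighbours y6 = (y5 , inj₂ e2) ∷ (y7 , inj₁ e3) ∷ (y4 , inj₂ e8) ∷ []
hNeighbours y7 = (y6 , inj₂ e3) ∷ (y3 , inj₁ e4) ∷ []
hNeighbours z1 = (z5 , inj₁ f1) ∷ (z2 , inj₂ f6) ∷ (y3 , inj₂ g3) ∷ []
hNeighbours z2 = (z3 , inj₂ f5) ∷ (z1 , inj₁ f6) ∷ (z4 , inj₁ f7) ∷ []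
hNeighbours z3 = (z7 , inj₂ f4) ∷ (z2 , inj₁ f5) ∷ []
hNeighbours z4 = (z2 , inj₂ f7) ∷ (z6 , inj₁ f8) ∷ (w , inj₂ g2) ∷ []
hNeighbours z5 = (z1 , inj₂ f1) ∷ (z6 , inj₁ f2) ∷ []
hNeighbours z6 = (z5 , inj₂ f2) ∷ (z7 , inj₁ f3) ∷ (z4 , inj₂ f8) ∷ []
hNeighbours z7 = (z6 , inj₂ f3) ∷ (z3 , inj₁ f4) ∷ (y5 , inj₂ g4) ∷ []
hNeighbours w  = (y4 , inj₂ g1) ∷ (z4 , inj₁ g2) ∷ []

vertices : Vec HV 15
vertices = y1 ∷ y2 ∷ y3 ∷ y4 ∷ y5 ∷ y6 ∷ y7 ∷ z1 ∷ z2 ∷ z3 ∷ z4 ∷ z5 ∷ z6 ∷ z7 ∷ w ∷ []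

index : HV → Fin 15
index y1 = Fin.# 0
index y2 = Fin.# 1
index y3 = Fin.# 2
index y4 = Fin.# 3
index y5 = Fin.# 4
index y6 = Fin.# 5
index y7 = Fin.# 6
index z1 = Fin.# 7
index z2 = Fin.# 8
index z3 = Fin.# 9
index z4 = Fin.# 10
index z5 = Fin.# 11
index z6 = Fin.# 12
index z7 = Fin.# 13
index w  = Fin.# 14

lookup-index : ∀ u → lookup vertices (index u) ≡ u
lookup-index y1 = refl
lookup-index y2 = refl
lookup-index y3 = refl
lookup-index y4 = refl
lookup-index y5 = refl
lookup-index y6 = refl
lookup-index y7 = refl
lookup-index z1 = refl
lookup-index z2 = refl
lookup-index z3 = refl
lookup-index z4 = refl
lookup-index z5 = refl
lookup-index z6 = refl
lookup-index z7 = refl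
lookup-index w  = refl

index-injective : ∀ {u v} → index u ≡ index v → u ≡ v
index-injective {u} {v} eq =
  trans (sym (lookup-index u)) (trans (cong (lookup vertices) eq) (lookup-index v))

_≟H_ : DecidableEquality HV
u ≟H v = map′ index-injective (cong index) (index u Fin.≟ index v)

∀HV? : {P : HV → Set} → (∀ u → Dec (P u)) → Dec (∀ u → P u)
∀HV? {P} P? = map′ (λ all-i u → subst P (lookup-index u) (all-i (index u)))
                   (λ all-u i → all-u (lookup vertices i))
                   (all? (P? ∘ lookup vertices))

∃HV? : {P : HV → Set} → (∀ u → Dec (P u)) → Dec (Σ HV P)
∃HV? {P} P? = map′ (λ (i , p) → lookup vertices i , p)
                   (λ (u , p) → index u , subst P (sym (lookup-index u)) p)
                   (any? (P? ∘ lookup vertices))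

open PathSearch _≟H_ hNeighbours renaming (pathWithin? to hPathWithin?)

-- The distance matrix of H (rows and columns in the order of vertices).
-- Only the fact that each entry bounds the distance from above is used.
distanceRow : HV → Vec ℕ 15
distanceRow y1 = 0 ∷ 1 ∷ 2 ∷ 2 ∷ 1 ∷ 2 ∷ 3 ∷ 3 ∷ 4 ∷ 3 ∷ 4 ∷ 4 ∷ 3 ∷ 2 ∷ 3 ∷ []
distanceRow y2 = 1 ∷ 0 ∷ 1 ∷ 1 ∷ 2 ∷ 2 ∷ 2 ∷ 2 ∷ 3 ∷ 4 ∷ 3 ∷ 3 ∷ 4 ∷ 3 ∷ 2 ∷ []
distanceRow y3 = 2 ∷ 1 ∷ 0 ∷ 2 ∷ 3 ∷ 2 ∷ 1 ∷ 1 ∷ 2 ∷ 3 ∷ 3 ∷ 2 ∷ 3 ∷ 4 ∷ 3 ∷ []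
distanceRow y4 = 2 ∷ 1 ∷ 2 ∷ 0 ∷ 2 ∷ 1 ∷ 2 ∷ 3 ∷ 3 ∷ 4 ∷ 2 ∷ 4 ∷ 3 ∷ 3 ∷ 1 ∷ []
distanceRow y5 = 1 ∷ 2 ∷ 3 ∷ 2 ∷ 0 ∷ 1 ∷ 2 ∷ 4 ∷ 3 ∷ 2 ∷ 3 ∷ 3 ∷ 2 ∷ 1 ∷ 3 ∷ []
distanceRow y6 = 2 ∷ 2 ∷ 2 ∷ 1 ∷ 1 ∷ 0 ∷ 1 ∷ 3 ∷ 4 ∷ 3 ∷ 3 ∷ 4 ∷ 3 ∷ 2 ∷ 2 ∷ []
distanceRow y7 = 3 ∷ 2 ∷ 1 ∷ 2 ∷ 2 ∷ 1 ∷ 0 ∷ 2 ∷ 3 ∷ 4 ∷ 4 ∷ 3 ∷ 4 ∷ 3 ∷ 3 ∷ []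
distanceRow z1 = 3 ∷ 2 ∷ 1 ∷ 3 ∷ 4 ∷ 3 ∷ 2 ∷ 0 ∷ 1 ∷ 2 ∷ 2 ∷ 1 ∷ 2 ∷ 3 ∷ 3 ∷ []
distanceRow z2 = 4 ∷ 3 ∷ 2 ∷ 3 ∷ 3 ∷ 4 ∷ 3 ∷ 1 ∷ 0 ∷ 1 ∷ 1 ∷ 2 ∷ 2 ∷ 2 ∷ 2 ∷ []
distanceRow z3 = 3 ∷ 4 ∷ 3 ∷ 4 ∷ 2 ∷ 3 ∷ 4 ∷ 2 ∷ 1 ∷ 0 ∷ 2 ∷ 3 ∷ 2 ∷ 1 ∷ 3 ∷ []
distanceRow z4 = 4 ∷ 3 ∷ 3 ∷ 2 ∷ 3 ∷ 3 ∷ 4 ∷ 2 ∷ 1 ∷ 2 ∷ 0 ∷ 2 ∷ 1 ∷ 2 ∷ 1 ∷ []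
distanceRow z5 = 4 ∷ 3 ∷ 2 ∷ 4 ∷ 3 ∷ 4 ∷ 3 ∷ 1 ∷ 2 ∷ 3 ∷ 2 ∷ 0 ∷ 1 ∷ 2 ∷ 3 ∷ []
distanceRow z6 = 3 ∷ 4 ∷ 3 ∷ 3 ∷ 2 ∷ 3 ∷ 4 ∷ 2 ∷ 2 ∷ 2 ∷ 1 ∷ 1 ∷ 0 ∷ 1 ∷ 2 ∷ []
distanceRow z7 = 2 ∷ 3 ∷ 4 ∷ 3 ∷ 1 ∷ 2 ∷ 3 ∷ 3 ∷ 2 ∷ 1 ∷ 2 ∷ 2 ∷ 1 ∷ 0 ∷ 3 ∷ []
distanceRow w  = 3 ∷ 2 ∷ 3 ∷ 1 ∷ 3 ∷ 2 ∷ 3 ∷ 3 ∷ 2 ∷ 3 ∷ 1 ∷ 3 ∷ 2 ∷ 3 ∷ 0 ∷ []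

distance : HV → HV → ℕ
distance u v = lookup (distanceRow u) (index v)

distance-certified : ∀ u v → T (is-just (hPathWithin? (distance u v) u v))
distance-certified = toWitness {a? = ∀HV? λ u → ∀HV? λ v → T? _} _

distance-sound : ∀ u v → Within HAdj u v (distance u v)
distance-sound u v = to-witness-T _ (distance-certified u v)

Conflict : HV → ℕ → HV → ℕ → Set
Conflict u k v l = u ≢ v × k ≡ l × Within HAdj u v k

conflict? : ∀ u k v l → Maybe (Conflict u k v l)
conflict? u k v l with k ℕ.≟ l | u ≟H v | distance u v ≤? k
... | yes refl | no u≢v | yes d≤k = just (u≢v , refl , within-mono d≤k (distance-sound u v))
... | _        | _      | _       = nothing

open Refutation Conflict conflict? (applyUpTo suc 6)

-- Fact (A): every colouring of H with colours 1..6 has a conflict.  The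
-- search order starts at the dense centre of H so that conflicts arise early.
H-not-6-packable : (g : HV → ℕ) → (∀ v → g v ∈ applyUpTo suc 6) → BadPair g
H-not-6-packable g g∈ = refutes-sound g g∈ searchOrder [] [] _
  where
  searchOrder : List HV
  searchOrder = y4 ∷ y2 ∷ y6 ∷ y3 ∷ y7 ∷ y5 ∷ y1 ∷ z1 ∷ z2 ∷ z7 ∷ z3 ∷ z6 ∷ z4 ∷ z5 ∷ w ∷ []

encode : V → (Fin 2 × HV) ⊎ Fin 5
encode (h j u) = inj₁ (j , u)
encode a = inj₂ 0F
encode b = inj₂ 1F
encode c = inj₂ 2F
encode d = inj₂ 3F
encode x = inj₂ 4F

decode : (Fin 2 × HV) ⊎ Fin 5 → V
decode (inj₁ (j , u)) = h j u
decode (inj₂ 0F) = a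
decode (inj₂ 1F) = b
decode (inj₂ 2F) = c
decode (inj₂ 3F) = d
decode (inj₂ 4F) = x

decode-encode : ∀ v → decode (encode v) ≡ v
decode-encode (h j u) = refl
decode-encode a = refl
decode-encode b = refl
decode-encode c = refl
decode-encode d = refl
decode-encode x = refl

_≟V_ : DecidableEquality V
u ≟V v = map′ encode-injective (cong encode)
              (Sum.≡-dec (Product.≡-dec Fin._≟_ _≟H_) Fin._≟_ (encode u) (encode v))
  where
  encode-injective : encode u ≡ encode v → u ≡ v
  encode-injective eq =
    trans (sym (decode-encode u)) (trans (cong decode eq) (decode-encode v))

copy-adj : ∀ j {u v} → HAdj u v → Adj (h j u) (h j v)
copy-adj j (inj₁ e) = inj₁ (inH e)
copy-adj j (inj₂ e) = inj₂ (inH e)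

attachments : (j : Fin 2) (u : HV) → List (Σ V (Adj (h j u)))
attachments one y1 = (a , inj₂ ea1) ∷ []
attachments two y1 = (a , inj₂ ea2) ∷ []
attachments one z3 = (b , inj₂ eb1) ∷ []
attachments two z3 = (b , inj₂ eb2) ∷ []
attachments one y7 = (c , inj₂ ec1) ∷ []
attachments two z5 = (c , inj₂ ec2) ∷ []
attachments one z5 = (d , inj₂ ed1) ∷ []
attachments two y7 = (d , inj₂ ed2) ∷ []
attachments one w  = (x , inj₂ ex1) ∷ []
attachments two w  = (x , inj₂ ex2) ∷ []
attachments _   _  = []

neighbours : (u : V) → List (Σ V (Adj u))
neighbours (h j u) =
  List.map (λ (v , e) → h j v , copy-adj j e) (hNeighbours u) ++ attachments j u
neighbours a = (h one y1 , inj₁ ea1) ∷ (h two y1 , inj₁ ea2) ∷ []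
neighbours b = (h one z3 , inj₁ eb1) ∷ (h two z3 , inj₁ eb2) ∷ []
neighbours c = (h one y7 , inj₁ ec1) ∷ (h two z5 , inj₁ ec2) ∷ []
neighbours d = (h one z5 , inj₁ ed1) ∷ (h two y7 , inj₁ ed2) ∷ []
neighbours x = (h one w  , inj₁ ex1) ∷ (h two w  , inj₁ ex2) ∷ []

within⇒distLE : ∀ {A} {_⟶_ : A → A → Set} (φ : A → V) →
                (∀ {u v} → u ⟶ v → Adj (φ u) (φ v)) →
                ∀ {u v n} → Within _⟶_ u v n → DistLE (φ u) (φ v) n
within⇒distLE {_⟶_ = _⟶_} φ hom (m , m≤n , p) = m , m≤n , walk p
  where
  walk : ∀ {u v m} → Path _⟶_ u v m → Walk (φ u) (φ v) m
  walk []       = here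
  walk (e ∷ p) = step (hom e) (walk p)

distLE-mono : ∀ {u v m n} → m ≤ n → DistLE u v m → DistLE u v n
distLE-mono m≤n (l , l≤m , p) = l , ≤-trans l≤m m≤n , p

open PathSearch _≟V_ neighbours renaming (pathWithin? to gPathWithin?)

copies-certified : ∀ u v → T (is-just (gPathWithin? 6 (h one u) (h two v)))
copies-certified = toWitness {a? = ∀HV? λ u → ∀HV? λ v → T? _} _

copies-close : ∀ u v → DistLE (h one u) (h two v) 6
copies-close u v = within⇒distLE id id (to-witness-T _ (copies-certified u v))

large : Fin 3 → ℕ
large i = 6 + toℕ i

large-colour : ∀ {n} → 6 ≤ n → n ≤ 8 → n ≡ 6 ⊎ n ≡ 7 ⊎ n ≡ 8
large-colour (s≤s (s≤s (s≤s (s≤s (s≤s (s≤s {n = m} z≤n)))))) n≤8 with m | n≤8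
... | 0 | _ = inj₁ refl
... | 1 | _ = inj₂ (inj₁ refl)
... | 2 | _ = inj₂ (inj₂ refl)
... | suc (suc (suc _)) | s≤s (s≤s (s≤s (s≤s (s≤s (s≤s (s≤s (s≤s ())))))))

h-injective : ∀ {j u v} → h j u ≡ h j v → u ≡ v
h-injective refl = refl

module _ (f : V → ℕ) (positive : ∀ v → 1 ≤ f v) (at-most-8 : ∀ v → f v ≤ 8)
         (packing : ∀ u v → ¬ (u ≡ v) → f u ≡ f v → ¬ DistLE u v (f u)) where

  -- A copy of H cannot carry a single colour ≥ 6: capping f at 6 would give
  -- a packing colouring of H with colours 1..6.
  one-large-colour-impossible : ∀ j →
    (∀ u v → 6 ≤ f (h j u) → 6 ≤ f (h j v) → f (h j u) ≡ f (h j v)) → ⊥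
  one-large-colour-impossible j same =
    no-conflict (H-not-6-packable capped (λ u → ⊓-colour 5 (positive (h j u))))
    where
    capped : HV → ℕ
    capped u = f (h j u) ⊓ 6

    no-conflict : BadPair capped → ⊥
    no-conflict (u , v , u≢v , capped-eq , near) =
      packing (h j u) (h j v) (u≢v ∘ h-injective) same-colour
        (distLE-mono (m⊓n≤m _ 6) (within⇒distLE (h j) (copy-adj j) near))
      where
      same-colour : f (h j u) ≡ f (h j v)
      same-colour = [ id , (λ (6≤u , 6≤v) → same u v 6≤u 6≤v) ]
                      (⊓-collision 6 (f (h j u)) (f (h j v)) capped-eq)

  Uses : Fin 2 → ℕ → Set
  Uses j k = Σ HV λ u → f (h j u) ≡ k

  -- Step (B): of two large colours, a copy uses at least one, since otherwise
  -- the third large colour k'' would be its only colour ≥ 6.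
  uses-one-of : ∀ j {k k' k''} → (∀ {n} → 6 ≤ n → n ≤ 8 → n ≡ k ⊎ n ≡ k' ⊎ n ≡ k'') →
                Uses j k ⊎ Uses j k'
  uses-one-of j {k} {k'} {k''} covers
    with ∃HV? (λ u → f (h j u) ℕ.≟ k) | ∃HV? (λ u → f (h j u) ℕ.≟ k')
  ... | yes uses-k | _           = inj₁ uses-k
  ... | no _       | yes uses-k' = inj₂ uses-k'
  ... | no no-k    | no no-k'    =
    ⊥-elim (one-large-colour-impossible j λ u v 6≤u 6≤v → trans (only u 6≤u) (sym (only v 6≤v)))
    where
    only : ∀ u → 6 ≤ f (h j u) → f (h j u) ≡ k''
    only u 6≤u with covers 6≤u (at-most-8 (h j u))
    ... | inj₁ eq          = ⊥-elim (no-k (u , eq))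
    ... | inj₂ (inj₁ eq)   = ⊥-elim (no-k' (u , eq))
    ... | inj₂ (inj₂ eq)   = eq

  copy-misses-at-most-one : ∀ j → MissesAtMostOne (Uses j ∘ large) 0F 1F 2F
  copy-misses-at-most-one j =
      uses-one-of j large-colour
    , uses-one-of j (λ p q → map₂ swap (large-colour p q))
    , uses-one-of j (λ p q → [ inj₂ ∘ inj₂ , map₂ inj₁ ] (large-colour p q))

  -- Steps (C) and (D): some large colour is used on both copies, but two
  -- vertices in different copies are too close to share a colour ≥ 6.
  no-packing-colouring : ⊥
  no-packing-colouring =
    no-shared-large-colour
      (common-of-three (copy-misses-at-most-one one) (copy-misses-at-most-one two))
    where
    no-shared-large-colour : Σ (Fin 3) (λ i → Uses one (large i) × Uses two (large i)) → ⊥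
    no-shared-large-colour (i , (u , fu≡k) , (v , fv≡k)) =
      packing (h one u) (h two v) (λ ()) (trans fu≡k (sym fv≡k))
        (distLE-mono (subst (6 ≤_) (sym fu≡k) (m≤m+n 6 (toℕ i))) (copies-close u v))

lemma3 : (k : ℕ) → k < 9 → ¬ PackingColouring k
lemma3 k k<9 (f , bounds , packing) =
  no-packing-colouring f (proj₁ ∘ bounds) (λ v → ≤-trans (proj₂ (bounds v)) (≤-pred k<9)) packing
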